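{- For no constant $\varepsilon>0$ does there exist a $\left(\frac{\sqrt5+1}{2}-\varepsilon\right)$-competitive online algorithm for $1|jrp,s=1,p_j=1,r_j|F_{\max}+c_\mathcal{Q}$.
   Context: Problem $1|jrp,s=1,p_j=1,r_j|F_{\max}+c_\mathcal{Q}$: jobs with processing time $1$ and nonnegative integer release dates $r_j$ (several jobs may share a release date) must be processed non-preemptively on a single machine (at most one job at a time). There is a single resource, required by every job; each replenishment of it costs $K:=K_0+K_1\ge0$ (part of the instance). A solution consists of start times $S_j$ (completion times $C_j=S_j+1$) and replenishment times $t_1<\dots<t_q$; it is feasible if no two jobs overlap and for each job $j$ some replenishment time lies in $[r_j,S_j]$. Its cost is $\max_j(C_j-r_j)+qK$. Online setting: jobs are not known in advance (neither their number nor their data); a job becomes known at its release date, and replenishment and scheduling decisions cannot be revoked. An online algorithm is $c$-competitive if on every instance its cost is at most $c$ times the optimal offline cost.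
   Formalization: Start times $S_j$ and replenishment times of all schedules, including those of online algorithms, are rational, as are the cost $K$ and the competitive ratio, which ranges over rationals below $\frac{\sqrt5+1}{2}$. -}

module Defs where

open import Data.Nat as ℕ using (ℕ)
open import Data.Integer using (+_)
open import Data.Rational using (ℚ; _/_; 0ℚ; 1ℚ; _+_; _-_; _*_; _⊔_; _≤_; _<_)
open import Data.Rational.Properties using (_≤?_)
open import Data.List using (List; []; _∷_; length; filter; lookup; upTo; zip; map; foldr)
open import Data.List.Membership.Propositional using (_∈_)
open import Data.List.Relation.Unary.Linked using (Linked)
open import Data.Fin using (Fin; toℕ)
open import Data.Product using (Σ; ∃; _×_; _,_)
open import Data.Sum using (_⊎_)
open import Relation.Nullary using (¬_)
open import Relation.Binary.PropositionalEquality using (_≡_; _≢_)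

toℚ : ℕ → ℚ
toℚ n = (+ n) / 1

-- An instance's job list: release dates r_j, listed in nondecreasing order
-- (job j is the j-th entry; jobs with equal release dates are interchangeable).
Sorted : List ℕ → Set
Sorted = Linked ℕ._≤_

record Schedule : Set where
  constructor mkSchedule
  field
    start : ℕ → ℚ
    reps  : List ℚ
open Schedule public

record Feasible (rs : List ℕ) (σ : Schedule) : Set where
  field
    repsIncreasing : Linked _<_ (reps σ)
    noOverlap : (i j : Fin (length rs)) → i ≢ j →
      (start σ (toℕ i) + 1ℚ ≤ start σ (toℕ j)) ⊎ (start σ (toℕ j) + 1ℚ ≤ start σ (toℕ i))
    replenished : (i : Fin (length rs)) →
      ∃ λ t → (t ∈ reps σ) × (toℚ (lookup rs i) ≤ t) × (t ≤ start σ (toℕ i))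

maxℚ : List ℚ → ℚ
maxℚ = foldr _⊔_ 0ℚ

maxFlow : List ℕ → Schedule → ℚ
maxFlow rs σ =
  maxℚ (map (λ { (i , r) → (start σ i + 1ℚ) - toℚ r }) (zip (upTo (length rs)) rs))

cost : ℚ → List ℕ → Schedule → ℚ
cost K rs σ = maxFlow rs σ + toℚ (length (reps σ)) * K

Algorithm : Set
Algorithm = ℚ → List ℕ → Schedule

releasedBy : ℚ → List ℕ → List ℕ
releasedBy t = filter (λ r → toℚ r ≤? t)

-- Online (non-anticipative): everything the algorithm does up to time t
-- (replenishments at times ≤ t, jobs started at times ≤ t and their start
-- times) depends only on K and the jobs released up to time t.
Online : Algorithm → Set
Online A =
  (K : ℚ) → 0ℚ ≤ K → (I I′ : List ℕ) → Sorted I → Sorted I′ → (t : ℚ) →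
  releasedBy t I ≡ releasedBy t I′ →
  (filter (_≤? t) (reps (A K I)) ≡ filter (_≤? t) (reps (A K I′)))
  × ((i : ℕ) → i ℕ.< length (releasedBy t I) →
       (start (A K I) i ≤ t) ⊎ (start (A K I′) i ≤ t) →
       start (A K I) i ≡ start (A K I′) i)

Competitive : ℚ → Algorithm → Set
Competitive c A =
  (K : ℚ) → 0ℚ ≤ K → (I : List ℕ) → Sorted I →
  Feasible I (A K I) × ((σ : Schedule) → Feasible I σ → cost K I (A K I) ≤ c * cost K I σ)

-- c < (√5+1)/2, expressed over ℚ: c < 1, or c² < c + 1.
BelowGoldenRatio : ℚ → Set
BelowGoldenRatio c = (c < 1ℚ) ⊎ (c * c < c + 1ℚ)

{-# OPTIONS --safe #-}
-- Release one job at time 0 and let the algorithm start it at time s.  If no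
-- further job arrives, it pays s + 1 + K against the optimum 1 + K.  If instead
-- a second job arrives at the first integer m > s, the algorithm has already
-- replenished for the first job before m, so it must replenish twice and pays
-- at least s + 1 + 2K, while replenishing once at m and running both jobs from
-- m costs at most s + 2 + K.  For c < 1 the first case with K = 0 is already
-- infeasible.  For 1 ≤ c, adding (c - 1) times the first ratio bound to the
-- second leaves K (c + 1 - c²) ≤ c², which fails for large K exactly when
-- c² < c + 1.
module Submission where

open import Defs
open import Data.Empty using (⊥-elim)
open import Data.Fin using () renaming (zero to fzero; suc to fsuc)
open import Data.Integer as ℤ using (+_)
import Data.Integer.Properties as ℤ
open import Data.List using (List; []; _∷_; length; filter)
open import Data.List.Membership.Propositional using (_∈_)
open import Data.List.Membership.Propositional.Properties using (∈-filter⁺; ∈-filter⁻)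
open import Data.List.Properties using (filter-accept; filter-reject)
open import Data.List.Relation.Unary.Any using (here; there)
open import Data.List.Relation.Unary.Linked using ([-]; _∷_)
open import Data.Nat as ℕ using (ℕ; zero; suc)
import Data.Nat.Coprimality as Coprime
open import Data.Nat.DivMod using (m≡m%n+[m/n]*n; m%n<n; m/n*n≤m)
import Data.Nat.Properties as ℕ
open import Data.Product using (Σ; ∃; _×_; _,_; proj₁; proj₂)
open import Data.Rational
open import Data.Rational.Properties
import Data.Rational.Solver as Solver
open import Data.Sum using (inj₁; inj₂)
open import Relation.Binary.PropositionalEquality
open import Relation.Nullary using (¬_; Dec; yes; no)

open Solver.+-*-Solver

toℚ≡mkℚ : ∀ n → toℚ n ≡ mkℚ (+ n) 0 (Coprime.sym (Coprime.1-coprimeTo n))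
toℚ≡mkℚ n = normalize-coprime (Coprime.sym (Coprime.1-coprimeTo n))

toℚ-suc : ∀ n → toℚ (suc n) ≡ toℚ n + 1ℚ
toℚ-suc n rewrite toℚ≡mkℚ n =
  /-cong (trans (cong +_ (ℕ.+-comm 1 n)) (cong (ℤ._+ + 1) (sym (ℤ.*-identityʳ (+ n))))) refl

toℚ-mono-≤ : ∀ {m n} → m ℕ.≤ n → toℚ m ≤ toℚ n
toℚ-mono-≤ {m} {n} m≤n rewrite toℚ≡mkℚ m | toℚ≡mkℚ n =
  *≤* (ℤ.*-monoʳ-≤-nonNeg (+ 1) (ℤ.+≤+ m≤n))

toℚ≤mkℚ : ∀ {n m d} .{c : Coprime.Coprime m (suc d)} → n ℕ.* suc d ℕ.≤ m → toℚ n ≤ mkℚ (+ m) d c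
toℚ≤mkℚ {n} {m} {d} h rewrite toℚ≡mkℚ n =
  *≤* (subst₂ ℤ._≤_ (ℤ.pos-* n (suc d)) (sym (ℤ.*-identityʳ (+ m))) (ℤ.+≤+ h))

mkℚ<toℚ : ∀ {n m d} .{c : Coprime.Coprime m (suc d)} → m ℕ.< n ℕ.* suc d → mkℚ (+ m) d c < toℚ n
mkℚ<toℚ {n} {m} {d} h rewrite toℚ≡mkℚ n =
  *<* (subst₂ ℤ._<_ (sym (ℤ.*-identityʳ (+ m))) (ℤ.pos-* n (suc d)) (ℤ.+<+ h))

∃ℕ-floor : ∀ {p} → 0ℚ ≤ p → ∃ λ n → toℚ n ≤ p × p < toℚ (suc n)
∃ℕ-floor {mkℚ (+ m) d _} _ = m ℕ./ q , toℚ≤mkℚ {m ℕ./ q} (m/n*n≤m m q) , mkℚ<toℚ {suc (m ℕ./ q)} m<[1+m/q]*q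
  where
  q : ℕ
  q = suc d
  m<[1+m/q]*q : m ℕ.< suc (m ℕ./ q) ℕ.* q
  m<[1+m/q]*q = subst (ℕ._< suc (m ℕ./ q) ℕ.* q) (sym (m≡m%n+[m/n]*n m q))
                      (ℕ.+-monoˡ-< (m ℕ./ q ℕ.* q) (m%n<n m q))
∃ℕ-floor {mkℚ ℤ.-[1+ _ ] _ _} (*≤* ())

∃ℕ-in-⟨p,p+1] : ∀ {p} → 0ℚ ≤ p → ∃ λ m → p < toℚ m × toℚ m ≤ p + 1ℚ
∃ℕ-in-⟨p,p+1] p≥0 with ∃ℕ-floor p≥0
... | n , n≤p , p<1+n = suc n , p<1+n , subst (_≤ _) (sym (toℚ-suc n)) (+-monoˡ-≤ 1ℚ n≤p)

p<q⇒0<q-p : ∀ {p q} → p < q → 0ℚ < q - p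
p<q⇒0<q-p {p} {q} p<q = subst (_< q - p) (+-inverseʳ p) (+-monoˡ-< (- p) p<q)

p+1≰p : ∀ p → ¬ (p + 1ℚ ≤ p)
p+1≰p p p+1≤p = <-irrefl refl
  (<-≤-trans (subst (_< p + 1ℚ) (+-identityʳ p) (+-monoʳ-< p (positive⁻¹ 1ℚ))) p+1≤p)

∈⇒1≤length : ∀ {A : Set} {x : A} {xs} → x ∈ xs → 1 ℕ.≤ length xs
∈⇒1≤length (here _)  = ℕ.s≤s ℕ.z≤n
∈⇒1≤length (there _) = ℕ.s≤s ℕ.z≤n

∈∧∈∧≢⇒2≤length : ∀ {A : Set} {x y : A} {xs} → x ∈ xs → y ∈ xs → x ≢ y → 2 ℕ.≤ length xs
∈∧∈∧≢⇒2≤length (here refl) (here refl) x≢y = ⊥-elim (x≢y refl)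
∈∧∈∧≢⇒2≤length (here refl) (there y∈)  _   = ℕ.s≤s (∈⇒1≤length y∈)
∈∧∈∧≢⇒2≤length (there x∈)  _           _   = ℕ.s≤s (∈⇒1≤length x∈)

first-flow≤maxFlow : ∀ rs σ → start σ 0 + 1ℚ ≤ maxFlow (0 ∷ rs) σ
first-flow≤maxFlow rs σ = subst (_≤ maxFlow (0 ∷ rs) σ) (+-identityʳ (start σ 0 + 1ℚ)) (p≤p⊔q _ _)

cost-lower-bound : ∀ {K} rs σ {k} → 0ℚ ≤ K → k ℕ.≤ length (reps σ) →
                   start σ 0 + 1ℚ + toℚ k * K ≤ cost K (0 ∷ rs) σ
cost-lower-bound rs σ K≥0 k≤q =
  +-mono-≤ (first-flow≤maxFlow rs σ) (*-monoʳ-≤-nonNeg _ {{nonNegative K≥0}} (toℚ-mono-≤ k≤q))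

single-job-schedule : Schedule
single-job-schedule = mkSchedule (λ _ → 0ℚ) (0ℚ ∷ [])

single-job-schedule-feasible : Feasible (0 ∷ []) single-job-schedule
single-job-schedule-feasible = record
  { repsIncreasing = [-]
  ; noOverlap      = λ { fzero fzero 0≢0 → ⊥-elim (0≢0 refl) }
  ; replenished    = λ { fzero → 0ℚ , here refl , ≤-refl , ≤-refl }
  }

single-job-schedule-cost : ∀ K → cost K (0 ∷ []) single-job-schedule ≡ 1ℚ + K
single-job-schedule-cost K = cong (λ x → 1ℚ + x) (*-identityˡ K)

batch-schedule : ℚ → Schedule
batch-schedule t = mkSchedule (λ { zero → t ; (suc _) → t + 1ℚ }) (t ∷ [])

batch-schedule-feasible : ∀ m → Feasible (0 ∷ m ∷ []) (batch-schedule (toℚ m))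
batch-schedule-feasible m = record
  { repsIncreasing = [-]
  ; noOverlap      = λ { fzero        fzero        0≢0 → ⊥-elim (0≢0 refl)
                       ; fzero        (fsuc fzero) _   → inj₁ ≤-refl
                       ; (fsuc fzero) fzero        _   → inj₂ ≤-refl
                       ; (fsuc fzero) (fsuc fzero) 1≢1 → ⊥-elim (1≢1 refl) }
  ; replenished    = λ { fzero        → t , here refl , toℚ-mono-≤ {0} {m} ℕ.z≤n , ≤-refl
                       ; (fsuc fzero) → t , here refl , ≤-refl , t≤t+1 }
  }
  where
  t : ℚ
  t = toℚ m
  t≤t+1 : t ≤ t + 1ℚ
  t≤t+1 = subst (_≤ t + 1ℚ) (+-identityʳ t) (+-monoʳ-≤ t (nonNegative⁻¹ 1ℚ))

batch-schedule-cost : ∀ K m {s} → 0ℚ ≤ s → toℚ m ≤ s + 1ℚ →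
                      cost K (0 ∷ m ∷ []) (batch-schedule (toℚ m)) ≤ s + 1ℚ + 1ℚ + K
batch-schedule-cost K m {s} s≥0 t≤s+1 =
  subst (λ qK → cost K (0 ∷ m ∷ []) (batch-schedule t) ≤ s + 1ℚ + 1ℚ + qK) (*-identityˡ K)
        (+-monoˡ-≤ (1ℚ * K) (⊔-lub first-flow (⊔-lub second-flow s+2≥0)))
  where
  t s+2 : ℚ
  t = toℚ m
  s+2 = s + 1ℚ + 1ℚ
  two≤s+2 : 1ℚ + 1ℚ ≤ s+2
  two≤s+2 = +-monoˡ-≤ 1ℚ (+-monoˡ-≤ 1ℚ s≥0)
  s+2≥0 : 0ℚ ≤ s+2
  s+2≥0 = ≤-trans (nonNegative⁻¹ (1ℚ + 1ℚ)) two≤s+2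
  first-flow : t + 1ℚ - 0ℚ ≤ s+2
  first-flow = subst (_≤ s+2) (sym (+-identityʳ (t + 1ℚ))) (+-monoˡ-≤ 1ℚ t≤s+1)
  second-flow : t + 1ℚ + 1ℚ - t ≤ s+2
  second-flow = subst (_≤ s+2)
    (solve 1 (λ t → con 1ℚ :+ con 1ℚ := t :+ con 1ℚ :+ con 1ℚ :- t) refl t) two≤s+2

releasedBy-before-second : ∀ {s m} → 0ℚ ≤ s → s < toℚ m →
                           releasedBy s (0 ∷ []) ≡ releasedBy s (0 ∷ m ∷ [])
releasedBy-before-second {s} {m} s≥0 s<m = begin
  releasedBy s (0 ∷ [])     ≡⟨ filter-accept released {0} {[]} s≥0 ⟩
  0 ∷ []                    ≡⟨ cong (0 ∷_) (filter-reject released {m} {[]} m≰s) ⟨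
  0 ∷ releasedBy s (m ∷ []) ≡⟨ filter-accept released {0} s≥0 ⟨
  releasedBy s (0 ∷ m ∷ []) ∎
  where
  open ≡-Reasoning
  released : ∀ r → Dec (toℚ r ≤ s)
  released r = toℚ r ≤? s
  m≰s : ¬ (toℚ m ≤ s)
  m≰s m≤s = <-irrefl refl (≤-<-trans m≤s s<m)

module Adversary {c : ℚ} {A : Algorithm} (online : Online A) (competitive : Competitive c A)
                 (K : ℚ) (K≥0 : 0ℚ ≤ K) where

  I₁ : List ℕ
  I₁ = 0 ∷ []

  σ₁ : Schedule
  σ₁ = A K I₁

  s : ℚ
  s = start σ₁ 0

  replenishment₁ : ∃ λ τ → τ ∈ reps σ₁ × 0ℚ ≤ τ × τ ≤ s
  replenishment₁ = Feasible.replenished (proj₁ (competitive K K≥0 I₁ [-])) fzero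

  τ : ℚ
  τ = proj₁ replenishment₁

  τ∈reps₁ : τ ∈ reps σ₁
  τ∈reps₁ = proj₁ (proj₂ replenishment₁)

  τ≤s : τ ≤ s
  τ≤s = proj₂ (proj₂ (proj₂ replenishment₁))

  s≥0 : 0ℚ ≤ s
  s≥0 = ≤-trans (proj₁ (proj₂ (proj₂ replenishment₁))) τ≤s

  single-job-bound : s + 1ℚ + K ≤ c * (1ℚ + K)
  single-job-bound = begin
    s + 1ℚ + K                             ≡⟨ cong (λ x → s + 1ℚ + x) (*-identityˡ K) ⟨
    s + 1ℚ + toℚ 1 * K                     ≤⟨ cost-lower-bound [] σ₁ K≥0 (∈⇒1≤length τ∈reps₁) ⟩
    cost K I₁ σ₁                           ≤⟨ proj₂ (competitive K K≥0 I₁ [-]) _ single-job-schedule-feasible ⟩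
    c * cost K I₁ single-job-schedule      ≡⟨ cong (c *_) (single-job-schedule-cost K) ⟩
    c * (1ℚ + K)                           ∎
    where open ≤-Reasoning hiding (start)

  m : ℕ
  m = proj₁ (∃ℕ-in-⟨p,p+1] s≥0)

  s<m : s < toℚ m
  s<m = proj₁ (proj₂ (∃ℕ-in-⟨p,p+1] s≥0))

  I₂ : List ℕ
  I₂ = 0 ∷ m ∷ []

  σ₂ : Schedule
  σ₂ = A K I₂

  m≤s+1 : toℚ m ≤ s + 1ℚ
  m≤s+1 = proj₂ (proj₂ (∃ℕ-in-⟨p,p+1] s≥0))

  same-releases-until-s : releasedBy s I₁ ≡ releasedBy s I₂
  same-releases-until-s = releasedBy-before-second s≥0 s<m

  same-replenishments-until-s : filter (_≤? s) (reps σ₁) ≡ filter (_≤? s) (reps σ₂)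
  same-replenishments-until-s = proj₁ (online K K≥0 I₁ I₂ [-] (ℕ.z≤n ∷ [-]) s same-releases-until-s)

  same-first-start : start σ₂ 0 ≡ s
  same-first-start =
    sym (proj₂ (online K K≥0 I₁ I₂ [-] (ℕ.z≤n ∷ [-]) s same-releases-until-s) 0 first-released (inj₁ ≤-refl))
    where
    first-released : 0 ℕ.< length (releasedBy s I₁)
    first-released = subst (λ rs → 0 ℕ.< length rs) (sym (filter-accept (λ r → toℚ r ≤? s) {0} {[]} s≥0)) ℕ.z<s

  τ∈reps₂ : τ ∈ reps σ₂
  τ∈reps₂ = proj₁ (∈-filter⁻ (_≤? s) (subst (τ ∈_) same-replenishments-until-s (∈-filter⁺ (_≤? s) τ∈reps₁ τ≤s)))

  two-replenishments : 2 ℕ.≤ length (reps σ₂)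
  two-replenishments =
    ∈∧∈∧≢⇒2≤length τ∈reps₂ (proj₁ (proj₂ replenishment₂))
      (λ τ≡τ′ → <-irrefl τ≡τ′ (≤-<-trans τ≤s (<-≤-trans s<m (proj₁ (proj₂ (proj₂ replenishment₂))))))
    where
    replenishment₂ : ∃ λ τ′ → τ′ ∈ reps σ₂ × toℚ m ≤ τ′ × τ′ ≤ start σ₂ 1
    replenishment₂ = Feasible.replenished (proj₁ (competitive K K≥0 I₂ (ℕ.z≤n ∷ [-]))) (fsuc fzero)

  two-job-bound : 0ℚ ≤ c → s + 1ℚ + toℚ 2 * K ≤ c * (s + 1ℚ + 1ℚ + K)
  two-job-bound c≥0 = begin
    s + 1ℚ + toℚ 2 * K                     ≡⟨ cong (λ x → x + 1ℚ + toℚ 2 * K) same-first-start ⟨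
    start σ₂ 0 + 1ℚ + toℚ 2 * K            ≤⟨ cost-lower-bound (m ∷ []) σ₂ K≥0 two-replenishments ⟩
    cost K I₂ σ₂                           ≤⟨ proj₂ (competitive K K≥0 I₂ (ℕ.z≤n ∷ [-])) _ (batch-schedule-feasible m) ⟩
    c * cost K I₂ (batch-schedule (toℚ m)) ≤⟨ *-monoˡ-≤-nonNeg c {{nonNegative c≥0}}
                                                (batch-schedule-cost K m s≥0 m≤s+1) ⟩
    c * (s + 1ℚ + 1ℚ + K)                  ∎
    where open ≤-Reasoning hiding (start)

one≤ratio : ∀ {c s} → 0ℚ ≤ s → s + 1ℚ + 0ℚ ≤ c * (1ℚ + 0ℚ) → 1ℚ ≤ c
one≤ratio {c} {s} s≥0 bound = begin
  1ℚ            ≤⟨ +-monoˡ-≤ 1ℚ s≥0 ⟩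
  s + 1ℚ        ≡⟨ +-identityʳ (s + 1ℚ) ⟨
  s + 1ℚ + 0ℚ   ≤⟨ bound ⟩
  c * 1ℚ        ≡⟨ *-identityʳ c ⟩
  c             ∎
  where open ≤-Reasoning hiding (start)

golden-gap : ∀ {c} → 1ℚ ≤ c → c * c < c + 1ℚ →
  ∃ λ K → 0ℚ ≤ K × ∀ s → s + 1ℚ + K ≤ c * (1ℚ + K) → ¬ (s + 1ℚ + toℚ 2 * K ≤ c * (s + 1ℚ + 1ℚ + K))
golden-gap {c} 1≤c c²<c+1 = K , K≥0 , λ s bound₁ bound₂ →
  p+1≰p (rhs s) (subst₂ _≤_ (combined≡ s) refl (+-mono-≤ (*-monoˡ-≤-nonNeg (c - 1ℚ) bound₁) bound₂))
  where
  d : ℚ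
  d = c + 1ℚ - c * c
  instance
    d-pos : Positive d
    d-pos = positive (p<q⇒0<q-p c²<c+1)
    d-nonZero : NonZero d
    d-nonZero = pos⇒nonZero d
    c-1-nonNeg : NonNegative (c - 1ℚ)
    c-1-nonNeg = nonNegative (subst (_≤ c - 1ℚ) (+-inverseʳ 1ℚ) (+-monoˡ-≤ (- 1ℚ) 1≤c))
    c-nonNeg : NonNegative c
    c-nonNeg = nonNegative (≤-trans (nonNegative⁻¹ 1ℚ) 1≤c)
    c²+1-nonNeg : NonNegative (c * c + 1ℚ)
    c²+1-nonNeg = nonNeg+nonNeg⇒nonNeg (c * c) {{nonNeg*nonNeg⇒nonNeg c c}} 1ℚ
    1/d-nonNeg : NonNegative (1/ d)
    1/d-nonNeg = pos⇒nonNeg (1/ d) {{1/pos⇒pos d}}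
  K : ℚ
  K = (c * c + 1ℚ) * 1/ d
  K≥0 : 0ℚ ≤ K
  K≥0 = nonNegative⁻¹ K {{nonNeg*nonNeg⇒nonNeg (c * c + 1ℚ) (1/ d)}}
  K*d≡c²+1 : K * d ≡ c * c + 1ℚ
  K*d≡c²+1 = trans (*-assoc (c * c + 1ℚ) (1/ d) d)
               (trans (cong ((c * c + 1ℚ) *_) (*-inverseˡ d)) (*-identityʳ (c * c + 1ℚ)))
  rhs : ℚ → ℚ
  rhs s = (c - 1ℚ) * (c * (1ℚ + K)) + c * (s + 1ℚ + 1ℚ + K)
  -- the two sides differ by K (c + 1 - c²) - c², which K was chosen to make 1
  combined≡ : ∀ s → (c - 1ℚ) * (s + 1ℚ + K) + (s + 1ℚ + toℚ 2 * K) ≡ rhs s + 1ℚ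
  combined≡ s = begin
    (c - 1ℚ) * (s + 1ℚ + K) + (s + 1ℚ + toℚ 2 * K) ≡⟨ solve 3 (λ c s K →
        (c :- con 1ℚ) :* (s :+ con 1ℚ :+ K) :+ (s :+ con 1ℚ :+ con (toℚ 2) :* K)
      := (c :- con 1ℚ) :* (c :* (con 1ℚ :+ K)) :+ c :* (s :+ con 1ℚ :+ con 1ℚ :+ K)
           :+ (K :* (c :+ con 1ℚ :- c :* c) :- c :* c)) refl c s K ⟩
    rhs s + (K * d - c * c)                        ≡⟨ cong (λ x → rhs s + (x - c * c)) K*d≡c²+1 ⟩
    rhs s + (c * c + 1ℚ - c * c)                   ≡⟨ cong (λ x → rhs s + x) (solve 1 (λ x → x :+ con 1ℚ :- x := con 1ℚ) refl (c * c)) ⟩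
    rhs s + 1ℚ                                     ∎
    where open ≡-Reasoning

not-competitive-below-one : ∀ {c A} → c < 1ℚ → Online A → ¬ Competitive c A
not-competitive-below-one {c} c<1 online competitive =
  <-irrefl refl (<-≤-trans c<1 (one≤ratio s≥0 single-job-bound))
  where open Adversary {c} online competitive 0ℚ ≤-refl

not-competitive-golden : ∀ {c A} → 1ℚ ≤ c → c * c < c + 1ℚ → Online A → ¬ Competitive c A
not-competitive-golden {c} 1≤c c²<c+1 online competitive =
  let K , K≥0 , incompatible = golden-gap 1≤c c²<c+1
      open Adversary {c} online competitive K K≥0
  in  incompatible s single-job-bound (two-job-bound (≤-trans (nonNegative⁻¹ 1ℚ) 1≤c))

theorem17 : (c : ℚ) → BelowGoldenRatio c → ¬ (Σ Algorithm λ A → Online A × Competitive c A)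
theorem17 c (inj₁ c<1)      (_ , online , competitive) = not-competitive-below-one c<1 online competitive
theorem17 c (inj₂ c²<c+1)   (_ , online , competitive) with c <? 1ℚ
... | yes c<1 = not-competitive-below-one c<1 online competitive
... | no c≮1  = not-competitive-golden (≮⇒≥ c≮1) c²<c+1 online competitive
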